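{- Let $n\ge 1$ and $x\in\mathbb{R}$. Let $G_n$ be the graph with vertex set $\{(i,j):1\le i,j\le n+1,\ i\ne j\}$ in which $(i,j)$ and $(i',j')$ are adjacent if $|i-i'|+|j-j'|=1$, and additionally $(j,j+1)$ and $(j+1,j)$ are adjacent for each $1\le j\le n$. Define $p^{(0)}_{ij}(x)=1$ for $i<j$ and $p^{(0)}_{ij}(x)=0$ for $i>j$, and for $t\ge0$ $$p^{(t+1)}_v(x)=p^{(t)}_v(x)+x\sum_{w\sim v \text{ in } G_n}\left(p^{(t)}_w(x)-p^{(t)}_v(x)\right).$$ For each $t$ let $q^{(t)}$ be the $(n+1)\times(n+1)$ matrix with $q^{(t)}_{ij}=p^{(t)}_{ij}(x)$ for $i\ne j$ and $q^{(t)}_{ii}=\tfrac12$. Let $H_n$ be the $(n+1)\times(n+1)$ grid graph with vertex set $\{1,\dots,n+1\}^2$, where $(i,j)\sim(i',j')$ iff $|i-i'|+|j-j'|=1$. Then for every $t\ge 0$ and every vertex $v$ of $H_n$ (including diagonal vertices), $$q^{(t+1)}_v=q^{(t)}_v+x\sum_{w\sim v \text{ in } H_n}\left(q^{(t)}_w-q^{(t)}_v\right),$$ i.e. the sequence of matrices $q^{(t)}$ is a heat flow process with conductivity $x$ on the grid graph $H_n$. -}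

module Defs where

open import Algebra.Bundles using (CommutativeRing)
open import Data.Bool using (Bool; true; false; if_then_else_; _∧_; _∨_; not)
open import Data.Nat using (ℕ; zero; suc; _≡ᵇ_; _<ᵇ_; ∣_-_∣)
import Data.Nat as ℕ
open import Data.Fin using (Fin; toℕ)
import Data.Fin as Fin

-- Heat flow on the graphs G_n and H_n, with values in a commutative ring R
-- (standing in for ℝ), conductivity x ∈ R, and vertices indexed
-- 0-based by Fin (suc n) × Fin (suc n) (paper: 1..n+1).
module HeatFlow {c ℓ} (R : CommutativeRing c ℓ) (x : CommutativeRing.Carrier R) (n : ℕ) where
  open CommutativeRing R

  V : Set
  V = Fin (suc n)

  sumFin : ∀ {m} → (Fin m → Carrier) → Carrier
  sumFin {zero}  f = 0#
  sumFin {suc m} f = f Fin.zero + sumFin (λ k → f (Fin.suc k))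

  sumGrid : (V → V → Carrier) → Carrier
  sumGrid f = sumFin (λ i' → sumFin (λ j' → f i' j'))

  gridAdj : V → V → V → V → Bool
  gridAdj i j i' j' = (∣ toℕ i - toℕ i' ∣ ℕ.+ ∣ toℕ j - toℕ j' ∣) ≡ᵇ 1

  extraAdj : V → V → V → V → Bool
  extraAdj i j i' j' = (toℕ i' ≡ᵇ toℕ j) ∧ (toℕ j' ≡ᵇ toℕ i) ∧ (∣ toℕ i - toℕ j ∣ ≡ᵇ 1)

  offDiag : V → V → Bool
  offDiag i j = not (toℕ i ≡ᵇ toℕ j)

  GAdj : V → V → V → V → Bool
  GAdj i j i' j' = offDiag i j ∧ offDiag i' j' ∧ (gridAdj i j i' j' ∨ extraAdj i j i' j')

  -- p^{(t)}_{ij}(x); its values at diagonal positions are irrelevant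
  -- (they are never used, and stay 0).
  p : ℕ → V → V → Carrier
  p zero    i j = if toℕ i <ᵇ toℕ j then 1# else 0#
  p (suc t) i j = p t i j + x * sumGrid (λ i' j' →
                    if GAdj i j i' j' then p t i' j' - p t i j else 0#)

  -- q^{(t)} with diagonal entries equal to `half` (= 1/2)
  q : (half : Carrier) → ℕ → V → V → Carrier
  q half t i j = if toℕ i ≡ᵇ toℕ j then half else p t i j

  heatStepH : (V → V → Carrier) → V → V → Carrier
  heatStepH f i j = f i j + x * sumGrid (λ i' j' →
                      if gridAdj i j i' j' then f i' j' - f i j else 0#)

module Submission where

-- Off the diagonal, p_ij + p_ji = 1 for every t: this holds at t = 0, and G_n is
-- invariant under the transposition (i, j) ↦ (j, i), so the Laplacian terms at
-- (i, j) and (j, i) cancel in pairs. Hence q_w + q_wᵀ = 1 for every vertex w. At a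
-- diagonal vertex the grid neighbours come in transposed pairs, so the Laplacian of q
-- vanishes and q stays 1/2. At an off-diagonal vertex (i, j) the two Laplacians differ
-- only when |i - j| = 1: the grid then has the diagonal neighbours (i, i) and (j, j),
-- contributing 2 (1/2 - p_ij), where G_n has the extra neighbour (j, i), contributing
-- p_ji - p_ij = 1 - 2 p_ij.

open import Defs
open import Algebra.Bundles using (CommutativeRing; CommutativeMonoid)
open import Data.Bool using (Bool; true; false; if_then_else_; _∧_; _∨_; not; T)
open import Data.Bool.Properties using (∧-zeroʳ; ∨-comm; if-∧; T-≡; T-not-≡; T-∧; ∧-commutativeMonoid)
open import Algebra.Properties.CommutativeSemigroup (CommutativeMonoid.commutativeSemigroup ∧-commutativeMonoid)
  using () renaming (x∙yz≈y∙xz to ∧-exchange)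
open import Data.Empty using (⊥; ⊥-elim)
open import Data.Fin using (Fin; toℕ; zero; suc)
import Data.Fin as Fin
open import Data.Fin.Properties using (toℕ-injective)
open import Data.Nat using (ℕ; _≤_; zero; suc; _≡ᵇ_; _<ᵇ_; ∣_-_∣)
import Data.Nat as ℕ
open import Data.Nat.Properties using (≡ᵇ⇒≡; ≡⇒≡ᵇ; ∣-∣-comm)
import Data.Nat.Properties as ℕₚ
open import Data.Product using (_,_; proj₁; proj₂)
open import Data.Unit using (tt)
open import Data.Vec.Functional using (Vector)
open import Function using (_∘_; Equivalence)
open import Relation.Binary.PropositionalEquality as ≡ using (_≡_; _≢_; refl; cong; cong₂)
open import Relation.Nullary using (yes; no)

≡ᵇ-sym : ∀ m n → (m ≡ᵇ n) ≡ (n ≡ᵇ m)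
≡ᵇ-sym zero    zero    = refl
≡ᵇ-sym zero    (suc n) = refl
≡ᵇ-sym (suc m) zero    = refl
≡ᵇ-sym (suc m) (suc n) = ≡ᵇ-sym m n

not-≡ᵇ⇒≢ : ∀ m n → T (not (m ≡ᵇ n)) → m ≢ n
not-≡ᵇ⇒≢ (suc m) (suc n) m≢n refl = not-≡ᵇ⇒≢ m n m≢n refl

≢⇒not-≡ᵇ : ∀ m n → m ≢ n → T (not (m ≡ᵇ n))
≢⇒not-≡ᵇ zero    zero    m≢n = m≢n refl
≢⇒not-≡ᵇ zero    (suc n) _   = tt
≢⇒not-≡ᵇ (suc m) zero    _   = tt
≢⇒not-≡ᵇ (suc m) (suc n) m≢n = ≢⇒not-≡ᵇ m n (m≢n ∘ cong suc)

diagonal-neighbourˡ : ∀ j c →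
  (∣ 0 - c ∣ ℕ.+ ∣ j - c ∣ ≡ᵇ 1) ≡ ((c ≡ᵇ 0) ∨ (c ≡ᵇ j)) ∧ (∣ 0 - j ∣ ≡ᵇ 1)
diagonal-neighbourˡ zero          zero          = refl
diagonal-neighbourˡ zero          (suc zero)    = refl
diagonal-neighbourˡ zero          (suc (suc c)) = refl
diagonal-neighbourˡ (suc j)       zero          = refl
diagonal-neighbourˡ (suc zero)    (suc zero)    = refl
diagonal-neighbourˡ (suc (suc j)) (suc zero)    = refl
diagonal-neighbourˡ (suc zero)    (suc (suc c)) = refl
diagonal-neighbourˡ (suc (suc j)) (suc (suc c)) = ≡.sym (∧-zeroʳ (c ≡ᵇ j))

diagonal-neighbour : ∀ i j c →
  (∣ i - c ∣ ℕ.+ ∣ j - c ∣ ≡ᵇ 1) ≡ ((c ≡ᵇ i) ∨ (c ≡ᵇ j)) ∧ (∣ i - j ∣ ≡ᵇ 1)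
diagonal-neighbour zero            j       c       = diagonal-neighbourˡ j c
diagonal-neighbour (suc i)         zero    c       = begin
  (∣ suc i - c ∣ ℕ.+ ∣ 0 - c ∣ ≡ᵇ 1)                   ≡⟨ cong (_≡ᵇ 1) (ℕₚ.+-comm ∣ suc i - c ∣ ∣ 0 - c ∣) ⟩
  (∣ 0 - c ∣ ℕ.+ ∣ suc i - c ∣ ≡ᵇ 1)                   ≡⟨ diagonal-neighbourˡ (suc i) c ⟩
  ((c ≡ᵇ 0) ∨ (c ≡ᵇ suc i)) ∧ (∣ 0 - suc i ∣ ≡ᵇ 1)   ≡⟨ cong (_∧ (suc i ≡ᵇ 1)) (∨-comm (c ≡ᵇ 0) (c ≡ᵇ suc i)) ⟩
  ((c ≡ᵇ suc i) ∨ (c ≡ᵇ 0)) ∧ (∣ suc i - 0 ∣ ≡ᵇ 1)   ∎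
  where open ≡.≡-Reasoning
diagonal-neighbour (suc zero)    (suc j) zero    = refl
diagonal-neighbour (suc (suc i)) (suc j) zero    = refl
diagonal-neighbour (suc i)       (suc j) (suc c) = diagonal-neighbour i j c

transpose-neither-diagonal-nor-adjacent : ∀ i j → T (∣ i - j ∣ ≡ᵇ 1) →
  T (not ((j ≡ᵇ i) ∨ (∣ i - j ∣ ℕ.+ ∣ j - i ∣ ≡ᵇ 1)))
transpose-neither-diagonal-nor-adjacent zero          (suc zero)    _ = tt
transpose-neither-diagonal-nor-adjacent (suc zero)    zero          _ = tt
transpose-neither-diagonal-nor-adjacent (suc i)       (suc j)       d = transpose-neither-diagonal-nor-adjacent i j d

extra-neighbour-neither-diagonal-nor-adjacent : ∀ i j a b →
  T ((a ≡ᵇ j) ∧ (b ≡ᵇ i) ∧ (∣ i - j ∣ ≡ᵇ 1)) →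
  T (not ((a ≡ᵇ b) ∨ (∣ i - a ∣ ℕ.+ ∣ j - b ∣ ≡ᵇ 1)))
extra-neighbour-neither-diagonal-nor-adjacent i j a b extra
  with a≡ᵇj , b≡ᵇi∧d ← Equivalence.to (T-∧ {a ≡ᵇ j}) extra
  with b≡ᵇi , d ← Equivalence.to (T-∧ {b ≡ᵇ i}) b≡ᵇi∧d
  with refl ← ≡ᵇ⇒≡ a j a≡ᵇj | refl ← ≡ᵇ⇒≡ b i b≡ᵇi
  = transpose-neither-diagonal-nor-adjacent i j d

module _ {c ℓ} (R : CommutativeRing c ℓ) where
  open CommutativeRing R hiding (zero) renaming (refl to ≈-refl)
  open import Algebra.Properties.AbelianGroup +-abelianGroup using (⁻¹-∙-comm)
  open import Algebra.Properties.CommutativeSemigroup +-commutativeSemigroup using (interchange)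
  open import Algebra.Properties.CommutativeMonoid.Sum +-commutativeMonoid
  open import Algebra.Properties.Group +-group using (∙-cancelʳ)
  open import Relation.Binary.Reasoning.Setoid setoid

  -‿interchange : ∀ u v a b → (u - a) + (v - b) ≈ (u + v) - (a + b)
  -‿interchange u v a b = trans (interchange u (- a) v (- b)) (+-congˡ (⁻¹-∙-comm a b))

  *-interchange : ∀ a b u v y → (a + y * u) + (b + y * v) ≈ (a + b) + y * (u + v)
  *-interchange a b u v y = trans (interchange a (y * u) b (y * v)) (+-congˡ (sym (distribˡ y u v)))

  ∑-zero : ∀ {m} {f : Vector Carrier m} → (∀ k → f k ≈ 0#) → sum f ≈ 0#
  ∑-zero {m} f≈0 = trans (sum-cong-≋ f≈0) (sum-replicate-zero m)

  ∑-point : ∀ {m} (c : Fin m) (h : Vector Carrier m) →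
    ∑[ k < m ] (if toℕ k ≡ᵇ toℕ c then h k else 0#) ≈ h c
  ∑-point {suc m} zero    h = trans (+-congˡ (sum-replicate-zero m)) (+-identityʳ _)
  ∑-point {suc m} (suc c) h = trans (+-identityˡ _) (∑-point c (h ∘ suc))

  ∑-point′ : ∀ {m} (c : Fin m) (h : Vector Carrier m) →
    ∑[ k < m ] (if toℕ c ≡ᵇ toℕ k then h k else 0#) ≈ h c
  ∑-point′ c h = trans (sum-cong-≋ λ k → reflexive (cong (if_then h k else 0#) (≡ᵇ-sym (toℕ c) (toℕ k))))
                       (∑-point c h)

  ∑-if : ∀ {m} b (f : Vector Carrier m) →
    ∑[ k < m ] (if b then f k else 0#) ≈ (if b then sum f else 0#)
  ∑-if     true  f = ≈-refl
  ∑-if {m} false f = sum-replicate-zero m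

  if-∨-disjoint : ∀ α β {u} → (T α → T β → ⊥) →
    (if α ∨ β then u else 0#) ≈ (if α then u else 0#) + (if β then u else 0#)
  if-∨-disjoint true  true  disjoint = ⊥-elim (disjoint _ _)
  if-∨-disjoint true  false _        = sym (+-identityʳ _)
  if-∨-disjoint false true  _        = sym (+-identityˡ _)
  if-∨-disjoint false false _        = sym (+-identityˡ 0#)

  ∑-two-points : ∀ {m} {c e : Fin m} → toℕ c ≢ toℕ e → ∀ δ u →
    ∑[ k < m ] (if ((toℕ k ≡ᵇ toℕ c) ∨ (toℕ k ≡ᵇ toℕ e)) ∧ δ then u else 0#)
      ≈ (if δ then u else 0#) + (if δ then u else 0#)
  ∑-two-points {m} {c} {e} c≢e δ u = begin
    ∑[ k < m ] (if (k ≐ c ∨ k ≐ e) ∧ δ then u else 0#)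
      ≈⟨ sum-cong-≋ (λ k → reflexive (if-∧ (k ≐ c ∨ k ≐ e))) ⟩
    ∑[ k < m ] (if k ≐ c ∨ k ≐ e then v else 0#)
      ≈⟨ sum-cong-≋ (λ k → if-∨-disjoint (k ≐ c) (k ≐ e) (disjoint k)) ⟩
    ∑[ k < m ] ((if k ≐ c then v else 0#) + (if k ≐ e then v else 0#))
      ≈⟨ ∑-distrib-+ (λ k → if k ≐ c then v else 0#) (λ k → if k ≐ e then v else 0#) ⟩
    ∑[ k < m ] (if k ≐ c then v else 0#) + ∑[ k < m ] (if k ≐ e then v else 0#)
      ≈⟨ +-cong (∑-point c (λ _ → v)) (∑-point e (λ _ → v)) ⟩
    v + v ∎
    where
    _≐_ : Fin m → Fin m → Bool
    k ≐ c = toℕ k ≡ᵇ toℕ c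
    v = if δ then u else 0#
    disjoint : ∀ k → T (k ≐ c) → T (k ≐ e) → ⊥
    disjoint k k≐c k≐e = c≢e (≡.trans (≡.sym (≡ᵇ⇒≡ (toℕ k) (toℕ c) k≐c)) (≡ᵇ⇒≡ (toℕ k) (toℕ e) k≐e))

  ∑∑-distrib-+ : ∀ {m m'} (f g : Fin m → Fin m' → Carrier) →
    ∑[ a < m ] ∑[ b < m' ] (f a b + g a b) ≈ ∑[ a < m ] ∑[ b < m' ] f a b + ∑[ a < m ] ∑[ b < m' ] g a b
  ∑∑-distrib-+ f g = trans (sum-cong-≋ λ a → ∑-distrib-+ (f a) (g a)) (∑-distrib-+ (λ a → sum (f a)) (λ a → sum (g a)))

  ∑∑-point : ∀ {m m'} (c : Fin m) (e : Fin m') δ (h : Fin m → Fin m' → Carrier) →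
    ∑[ a < m ] ∑[ b < m' ] (if (toℕ a ≡ᵇ toℕ c) ∧ (toℕ b ≡ᵇ toℕ e) ∧ δ then h a b else 0#)
      ≈ (if δ then h c e else 0#)
  ∑∑-point {m} {m'} c e δ h = begin
    ∑[ a < m ] ∑[ b < m' ] (if a ≐ c ∧ b ≐ e ∧ δ then h a b else 0#)
      ≈⟨ sum-cong-≋ (λ a → sum-cong-≋ (λ b → reflexive (≡.trans (if-∧ (a ≐ c))
                                                         (cong (if a ≐ c then_else 0#) (if-∧ (b ≐ e)))))) ⟩
    ∑[ a < m ] ∑[ b < m' ] (if a ≐ c then (if b ≐ e then h′ a b else 0#) else 0#)
      ≈⟨ sum-cong-≋ (λ a → ∑-if (a ≐ c) (λ b → if b ≐ e then h′ a b else 0#)) ⟩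
    ∑[ a < m ] (if a ≐ c then ∑[ b < m' ] (if b ≐ e then h′ a b else 0#) else 0#)
      ≈⟨ ∑-point c (λ a → ∑[ b < m' ] (if b ≐ e then h′ a b else 0#)) ⟩
    ∑[ b < m' ] (if b ≐ e then h′ c b else 0#)
      ≈⟨ ∑-point e (h′ c) ⟩
    h′ c e ∎
    where
    _≐_ : ∀ {k} → Fin k → Fin k → Bool
    a ≐ c = toℕ a ≡ᵇ toℕ c
    h′ : Fin m → Fin m' → Carrier
    h′ a b = if δ then h a b else 0#

  ∑∑-diagonal : ∀ {m} (h : Fin m → Fin m → Carrier) →
    ∑[ a < m ] ∑[ b < m ] (if toℕ a ≡ᵇ toℕ b then h a b else 0#) ≈ ∑[ c < m ] h c c
  ∑∑-diagonal h = sum-cong-≋ λ a → ∑-point′ a (h a)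

  <ᵇ-complement : ∀ m n → T (not (m ≡ᵇ n)) →
    (if m <ᵇ n then 1# else 0#) + (if n <ᵇ m then 1# else 0#) ≈ 1#
  <ᵇ-complement zero    (suc n) _   = +-identityʳ 1#
  <ᵇ-complement (suc m) zero    _   = +-identityˡ 1#
  <ᵇ-complement (suc m) (suc n) m≢n = <ᵇ-complement m n m≢n

  x+x≈0⇒x≈0 : ∀ {half} → half + half ≈ 1# → ∀ {u} → u + u ≈ 0# → u ≈ 0#
  x+x≈0⇒x≈0 {half} half+half≈1 {u} u+u≈0 = begin
    u                   ≈⟨ *-identityˡ u ⟨
    1# * u              ≈⟨ *-congʳ half+half≈1 ⟨
    (half + half) * u   ≈⟨ distribʳ u half half ⟩
    half * u + half * u ≈⟨ distribˡ half u u ⟨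
    half * (u + u)      ≈⟨ *-congˡ u+u≈0 ⟩
    half * 0#           ≈⟨ zeroʳ half ⟩
    0# ∎

  -‿halves : ∀ {half a b} → half + half ≈ 1# → a + b ≈ 1# → (half - a) + (half - a) ≈ b - a
  -‿halves {half} {a} {b} half+half≈1 a+b≈1 = begin
    (half - a) + (half - a) ≈⟨ -‿interchange half half a a ⟩
    (half + half) - (a + a) ≈⟨ +-congʳ (trans half+half≈1 (sym a+b≈1)) ⟩
    (a + b) - (a + a)       ≈⟨ +-congʳ (+-comm a b) ⟩
    (b + a) - (a + a)       ≈⟨ -‿interchange b a a a ⟨
    (b - a) + (a - a)       ≈⟨ +-congˡ (-‿inverseʳ a) ⟩
    (b - a) + 0#            ≈⟨ +-identityʳ (b - a) ⟩
    b - a ∎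

  balanced-differences-cancel : ∀ β {u v a a′} → (T β → u + v ≈ a + a′) →
    (if β then u - a else 0#) + (if β then v - a′ else 0#) ≈ 0#
  balanced-differences-cancel false                   _         = +-identityʳ 0#
  balanced-differences-cancel true  {u} {v} {a} {a′} balanced = begin
    (u - a) + (v - a′)   ≈⟨ -‿interchange u v a a′ ⟩
    (u + v) - (a + a′)   ≈⟨ +-congʳ (balanced tt) ⟩
    (a + a′) - (a + a′)  ≈⟨ -‿inverseʳ (a + a′) ⟩
    0# ∎

  -- One neighbour w of an off-diagonal vertex v: e₀ and e say whether v and w are
  -- diagonal, g and x whether w is a grid or an extra neighbour of v.
  H-term+extra-term≈G-term+diagonal-term : ∀ e₀ e g x {half P A} → T (not e₀) → (T x → T (not (e ∨ g))) →
    (if g then (if e then half else P) - (if e₀ then half else A) else 0#) + (if x then P - A else 0#)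
      ≈ (if not e₀ ∧ not e ∧ (g ∨ x) then P - A else 0#) + (if e then (if g then half - A else 0#) else 0#)
  H-term+extra-term≈G-term+diagonal-term false true  true  false _ _        = +-comm _ _
  H-term+extra-term≈G-term+diagonal-term false true  false false _ _        = ≈-refl
  H-term+extra-term≈G-term+diagonal-term false false true  false _ _        = ≈-refl
  H-term+extra-term≈G-term+diagonal-term false false false true  _ _        = +-comm _ _
  H-term+extra-term≈G-term+diagonal-term false false false false _ _        = ≈-refl
  H-term+extra-term≈G-term+diagonal-term false true  _     true  _ isolated = ⊥-elim (isolated tt)
  H-term+extra-term≈G-term+diagonal-term false false true  true  _ isolated = ⊥-elim (isolated tt)

  module _ (x : Carrier) (n : ℕ) where
    open HeatFlow R x n

    laplacian : (V → V → V → V → Bool) → (V → V → Carrier) → V → V → Carrier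
    laplacian adj f i j = ∑[ a < suc n ] ∑[ b < suc n ] (if adj i j a b then f a b - f i j else 0#)

    sumFin≡sum : ∀ {m} (f : Vector Carrier m) → sumFin f ≡ sum f
    sumFin≡sum {zero}  f = refl
    sumFin≡sum {suc m} f = cong (f zero +_) (sumFin≡sum (f ∘ suc))

    sumGrid≈∑∑ : ∀ (g : V → V → Carrier) → sumGrid g ≈ ∑[ a < suc n ] ∑[ b < suc n ] g a b
    sumGrid≈∑∑ g = trans (reflexive (sumFin≡sum (λ a → sumFin (g a))))
                         (sum-cong-≋ λ a → reflexive (sumFin≡sum (g a)))

    step≈laplacian-step : ∀ adj f i j →
      f i j + x * sumGrid (λ a b → if adj i j a b then f a b - f i j else 0#)
        ≈ f i j + x * laplacian adj f i j
    step≈laplacian-step adj f i j =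
      +-congˡ (*-congˡ (sumGrid≈∑∑ (λ a b → if adj i j a b then f a b - f i j else 0#)))

    laplacian-transpose : ∀ adj f i j →
      (∀ a b → adj j i b a ≡ adj i j a b) →
      (∀ a b → T (adj i j a b) → f a b + f b a ≈ f i j + f j i) →
      laplacian adj f i j + laplacian adj f j i ≈ 0#
    laplacian-transpose adj f i j adj-transpose balanced = begin
      laplacian adj f i j + laplacian adj f j i
        ≈⟨ +-congˡ (∑-comm (λ a b → if adj j i a b then f a b - f j i else 0#)) ⟩
      laplacian adj f i j + ∑[ a < suc n ] ∑[ b < suc n ] (if adj j i b a then f b a - f j i else 0#)
        ≈⟨ +-congˡ (sum-cong-≋ λ a → sum-cong-≋ λ b →
             reflexive (cong (if_then f b a - f j i else 0#) (adj-transpose a b))) ⟩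
      laplacian adj f i j + ∑[ a < suc n ] ∑[ b < suc n ] (if adj i j a b then f b a - f j i else 0#)
        ≈⟨ ∑∑-distrib-+ (λ a b → if adj i j a b then f a b - f i j else 0#)
                        (λ a b → if adj i j a b then f b a - f j i else 0#) ⟨
      ∑[ a < suc n ] ∑[ b < suc n ] ((if adj i j a b then f a b - f i j else 0#)
                                      + (if adj i j a b then f b a - f j i else 0#))
        ≈⟨ ∑-zero (λ a → ∑-zero (λ b → balanced-differences-cancel (adj i j a b) (balanced a b))) ⟩
      0# ∎

    gridAdj-transpose : ∀ i j a b → gridAdj j i b a ≡ gridAdj i j a b
    gridAdj-transpose i j a b = cong (_≡ᵇ 1) (ℕₚ.+-comm ∣ toℕ j - toℕ b ∣ ∣ toℕ i - toℕ a ∣)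

    offDiag-transpose : ∀ i j → offDiag j i ≡ offDiag i j
    offDiag-transpose i j = cong not (≡ᵇ-sym (toℕ j) (toℕ i))

    extraAdj-transpose : ∀ i j a b → extraAdj j i b a ≡ extraAdj i j a b
    extraAdj-transpose i j a b =
      ≡.trans (cong (λ d → (toℕ b ≡ᵇ toℕ i) ∧ (toℕ a ≡ᵇ toℕ j) ∧ (d ≡ᵇ 1)) (∣-∣-comm (toℕ j) (toℕ i)))
              (∧-exchange (toℕ b ≡ᵇ toℕ i) (toℕ a ≡ᵇ toℕ j) (∣ toℕ i - toℕ j ∣ ≡ᵇ 1))

    GAdj-transpose : ∀ i j a b → GAdj j i b a ≡ GAdj i j a b
    GAdj-transpose i j a b =
      cong₂ _∧_ (offDiag-transpose i j)
        (cong₂ _∧_ (offDiag-transpose a b)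
          (cong₂ _∨_ (gridAdj-transpose i j a b) (extraAdj-transpose i j a b)))

    GAdj⇒offDiag : ∀ i j a b → T (GAdj i j a b) → T (offDiag a b)
    GAdj⇒offDiag i j a b adj =
      proj₁ (Equivalence.to (T-∧ {offDiag a b}) (proj₂ (Equivalence.to (T-∧ {offDiag i j}) adj)))

    ∑-diagonal-neighbours : ∀ i j → toℕ i ≢ toℕ j → ∀ u →
      ∑[ a < suc n ] ∑[ b < suc n ] (if toℕ a ≡ᵇ toℕ b then (if gridAdj i j a b then u else 0#) else 0#)
        ≈ (if ∣ toℕ i - toℕ j ∣ ≡ᵇ 1 then u else 0#) + (if ∣ toℕ i - toℕ j ∣ ≡ᵇ 1 then u else 0#)
    ∑-diagonal-neighbours i j i≢j u = begin
      ∑[ a < suc n ] ∑[ b < suc n ] (if toℕ a ≡ᵇ toℕ b then (if gridAdj i j a b then u else 0#) else 0#)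
        ≈⟨ ∑∑-diagonal (λ a b → if gridAdj i j a b then u else 0#) ⟩
      ∑[ c < suc n ] (if gridAdj i j c c then u else 0#)
        ≈⟨ sum-cong-≋ {suc n} (λ c → reflexive (cong (if_then u else 0#)
                                                   (diagonal-neighbour (toℕ i) (toℕ j) (toℕ c)))) ⟩
      ∑[ c < suc n ] (if ((toℕ c ≡ᵇ toℕ i) ∨ (toℕ c ≡ᵇ toℕ j)) ∧ (∣ toℕ i - toℕ j ∣ ≡ᵇ 1) then u else 0#)
        ≈⟨ ∑-two-points i≢j (∣ toℕ i - toℕ j ∣ ≡ᵇ 1) u ⟩
      (if ∣ toℕ i - toℕ j ∣ ≡ᵇ 1 then u else 0#) + (if ∣ toℕ i - toℕ j ∣ ≡ᵇ 1 then u else 0#) ∎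

    p-complement : ∀ t i j → T (offDiag i j) → p t i j + p t j i ≈ 1#
    p-complement zero    i j i≢j = <ᵇ-complement (toℕ i) (toℕ j) i≢j
    p-complement (suc t) i j i≢j = begin
      p (suc t) i j + p (suc t) j i
        ≈⟨ +-cong (step≈laplacian-step GAdj (p t) i j) (step≈laplacian-step GAdj (p t) j i) ⟩
      (p t i j + x * laplacian GAdj (p t) i j) + (p t j i + x * laplacian GAdj (p t) j i)
        ≈⟨ *-interchange _ _ _ _ x ⟩
      (p t i j + p t j i) + x * (laplacian GAdj (p t) i j + laplacian GAdj (p t) j i)
        ≈⟨ +-cong (p-complement t i j i≢j)
                  (*-congˡ (laplacian-transpose GAdj (p t) i j (GAdj-transpose i j) balanced)) ⟩
      1# + x * 0#   ≈⟨ +-congˡ (zeroʳ x) ⟩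
      1# + 0#       ≈⟨ +-identityʳ 1# ⟩
      1# ∎
      where
      balanced : ∀ a b → T (GAdj i j a b) → p t a b + p t b a ≈ p t i j + p t j i
      balanced a b adj = trans (p-complement t a b (GAdj⇒offDiag i j a b adj)) (sym (p-complement t i j i≢j))

    module _ (half : Carrier) (half+half≈1 : half + half ≈ 1#) where

      q-diagonal : ∀ t i → q half t i i ≡ half
      q-diagonal t i = cong (if_then half else p t i i) (Equivalence.to T-≡ (≡⇒≡ᵇ (toℕ i) (toℕ i) refl))

      q-offDiagonal : ∀ t i j → T (offDiag i j) → q half t i j ≡ p t i j
      q-offDiagonal t i j i≢j = cong (if_then half else p t i j) (Equivalence.to T-not-≡ i≢j)

      q-complement : ∀ t a b → q half t a b + q half t b a ≈ 1#
      q-complement t a b rewrite ≡ᵇ-sym (toℕ b) (toℕ a) with toℕ a ≡ᵇ toℕ b in a≐b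
      ... | true  = half+half≈1
      ... | false = p-complement t a b (Equivalence.from T-not-≡ a≐b)

      laplacian-q-diagonal : ∀ t i → laplacian gridAdj (q half t) i i ≈ 0#
      laplacian-q-diagonal t i =
        x+x≈0⇒x≈0 half+half≈1 (laplacian-transpose gridAdj (q half t) i i (gridAdj-transpose i i) balanced)
        where
        balanced : ∀ a b → T (gridAdj i i a b) → q half t a b + q half t b a ≈ q half t i i + q half t i i
        balanced a b _ = trans (q-complement t a b) (sym (q-complement t i i))

      laplacian-q-offDiagonal : ∀ t i j → T (offDiag i j) →
        laplacian gridAdj (q half t) i j ≈ laplacian GAdj (p t) i j
      laplacian-q-offDiagonal t i j i≢j = ∙-cancelʳ X _ _ (begin
        laplacian gridAdj (q half t) i j + X
          ≈⟨ ∑∑-distrib-+ H-term X-term ⟨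
        ∑[ a < suc n ] ∑[ b < suc n ] (H-term a b + X-term a b)
          ≈⟨ sum-cong-≋ (λ a → sum-cong-≋ λ b →
               H-term+extra-term≈G-term+diagonal-term (toℕ i ≡ᵇ toℕ j) (toℕ a ≡ᵇ toℕ b) (gridAdj i j a b) (extraAdj i j a b)
                 {half} {p t a b} {A} i≢j
                 (extra-neighbour-neither-diagonal-nor-adjacent (toℕ i) (toℕ j) (toℕ a) (toℕ b))) ⟩
        ∑[ a < suc n ] ∑[ b < suc n ] (G-term a b + D-term a b)
          ≈⟨ ∑∑-distrib-+ G-term D-term ⟩
        laplacian GAdj (p t) i j + D
          ≈⟨ +-congˡ (trans diagonal-neighbours (sym transposed-neighbour)) ⟩
        laplacian GAdj (p t) i j + X ∎)
        where
        A = p t i j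
        d = ∣ toℕ i - toℕ j ∣ ≡ᵇ 1
        H-term X-term G-term D-term : V → V → Carrier
        H-term a b = if gridAdj i j a b then q half t a b - q half t i j else 0#
        X-term a b = if extraAdj i j a b then p t a b - A else 0#
        G-term a b = if GAdj i j a b then p t a b - A else 0#
        D-term a b = if toℕ a ≡ᵇ toℕ b then (if gridAdj i j a b then half - A else 0#) else 0#
        X = ∑[ a < suc n ] ∑[ b < suc n ] X-term a b
        D = ∑[ a < suc n ] ∑[ b < suc n ] D-term a b

        transposed-neighbour : X ≈ (if d then p t j i - A else 0#)
        transposed-neighbour = ∑∑-point j i d (λ a b → p t a b - A)

        doubled : ∀ δ → (if δ then half - A else 0#) + (if δ then half - A else 0#) ≈ (if δ then p t j i - A else 0#)
        doubled false = +-identityʳ 0#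
        doubled true  = -‿halves half+half≈1 (p-complement t i j i≢j)

        diagonal-neighbours : D ≈ (if d then p t j i - A else 0#)
        diagonal-neighbours = trans (∑-diagonal-neighbours i j (not-≡ᵇ⇒≢ (toℕ i) (toℕ j) i≢j) (half - A))
                                    (doubled d)

      q-heat-step : ∀ t i j → q half (suc t) i j ≈ heatStepH (q half t) i j
      q-heat-step t i j with i Fin.≟ j
      ... | yes refl = begin
        q half (suc t) i i
          ≡⟨ q-diagonal (suc t) i ⟩
        half
          ≈⟨ +-identityʳ half ⟨
        half + 0#
          ≈⟨ +-congˡ (trans (*-congˡ (laplacian-q-diagonal t i)) (zeroʳ x)) ⟨
        half + x * laplacian gridAdj (q half t) i i
          ≡⟨ cong (_+ x * laplacian gridAdj (q half t) i i) (q-diagonal t i) ⟨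
        q half t i i + x * laplacian gridAdj (q half t) i i
          ≈⟨ step≈laplacian-step gridAdj (q half t) i i ⟨
        heatStepH (q half t) i i ∎
      ... | no i≢j = begin
        q half (suc t) i j
          ≡⟨ q-offDiagonal (suc t) i j offDiag-ij ⟩
        p (suc t) i j
          ≈⟨ step≈laplacian-step GAdj (p t) i j ⟩
        p t i j + x * laplacian GAdj (p t) i j
          ≈⟨ +-cong (reflexive (q-offDiagonal t i j offDiag-ij))
                    (*-congˡ (laplacian-q-offDiagonal t i j offDiag-ij)) ⟨
        q half t i j + x * laplacian gridAdj (q half t) i j
          ≈⟨ step≈laplacian-step gridAdj (q half t) i j ⟨
        heatStepH (q half t) i j ∎
        where
        offDiag-ij : T (offDiag i j)
        offDiag-ij = ≢⇒not-≡ᵇ (toℕ i) (toℕ j) (i≢j ∘ toℕ-injective)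

proposition2 : ∀ {c ℓ} (R : CommutativeRing c ℓ) (half : CommutativeRing.Carrier R)
    → CommutativeRing._≈_ R (CommutativeRing._+_ R half half) (CommutativeRing.1# R)
    → (x : CommutativeRing.Carrier R) (n : ℕ) → 1 ≤ n
    → (t : ℕ) (i j : Fin (suc n))
    → CommutativeRing._≈_ R (HeatFlow.q R x n half (suc t) i j)
        (HeatFlow.heatStepH R x n (HeatFlow.q R x n half t) i j)
proposition2 R half half+half≈1 x n _ = q-heat-step R x n half half+half≈1
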